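{- Let $G=(V,E)$ be a weighted multi-graph on $n$ vertices with integer edge weights in $\{1,\dots,W\}$ and capacities $\{b_v\}_{v\in V}$, and let $M_G$ be a maximum weight $b$-matching of $G$. Then the number of edges of $G$ satisfies $|G| \leq 2n \cdot |M_G|$.
   Context: A weighted multi-graph $G=(V,E)$ has a multi-set of weighted edges $(u,v,k)$ with $u\neq v$ and weight $k\in\{1,\dots,W\}$; $|G|$ counts edges with multiplicity. Each vertex $v$ has a positive integer capacity $b_v$, and the number of edges between any two vertices $u,v$ is at most $\min(b_u,b_v)$. A $b$-matching is a multi-set $M$ of edges with at most $b_v$ edges of $M$ incident to each $v$; $|M|$ is its number of edges and $w(M)$ its total weight. -}

module Defs where

open import Data.Nat using (ℕ; _+_; _≤_; _⊓_)
open import Data.Fin using (Fin; _≟_)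
open import Data.Bool using (Bool; true; false; _∧_; _∨_)
open import Data.List using (List; []; _∷_; length; map)
open import Data.Nat.ListAction using (sum)
open import Data.List.Relation.Unary.All using (All)
open import Data.List.Relation.Binary.Sublist.Propositional using (_⊆_)
open import Data.Product using (_×_)
open import Relation.Nullary using (¬_)
open import Relation.Nullary.Decidable using (⌊_⌋)
open import Relation.Binary.PropositionalEquality using (_≡_)

record Edge (n : ℕ) : Set where
  constructor edge
  field
    src : Fin n
    dst : Fin n
    wt  : ℕ
open Edge public

WMultiGraph : ℕ → Set
WMultiGraph n = List (Edge n)

size : ∀ {n} → List (Edge n) → ℕ
size = length

weight : ∀ {n} → List (Edge n) → ℕ
weight M = sum (map wt M)

incident : ∀ {n} → Fin n → Edge n → Bool
incident x e = ⌊ src e ≟ x ⌋ ∨ ⌊ dst e ≟ x ⌋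

joins : ∀ {n} → Fin n → Fin n → Edge n → Bool
joins x y e = (⌊ src e ≟ x ⌋ ∧ ⌊ dst e ≟ y ⌋) ∨ (⌊ src e ≟ y ⌋ ∧ ⌊ dst e ≟ x ⌋)

countB : ∀ {A : Set} → (A → Bool) → List A → ℕ
countB p [] = 0
countB p (x ∷ xs) with p x
... | true  = 1 + countB p xs
... | false = countB p xs

degree : ∀ {n} → List (Edge n) → Fin n → ℕ
degree M x = countB (incident x) M

ValidGraph : ∀ {n} → ℕ → (Fin n → ℕ) → WMultiGraph n → Set
ValidGraph {n} W b G =
  All (λ e → ¬ (src e ≡ dst e) × 1 ≤ wt e × wt e ≤ W) G
  × (∀ (x : Fin n) → 1 ≤ b x)
  × (∀ (x y : Fin n) → ¬ (x ≡ y) → countB (joins x y) G ≤ b x ⊓ b y)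

-- M is a b-matching of G: a sub-multiset of G (as a sublist; order is
-- irrelevant for multisets) respecting all capacities
IsBMatching : ∀ {n} → (Fin n → ℕ) → WMultiGraph n → List (Edge n) → Set
IsBMatching {n} b G M = (M ⊆ G) × (∀ (x : Fin n) → degree M x ≤ b x)

IsMaxWeightBMatching : ∀ {n} → (Fin n → ℕ) → WMultiGraph n → List (Edge n) → Set
IsMaxWeightBMatching b G M =
  IsBMatching b G M × (∀ M' → IsBMatching b G M' → weight M' ≤ weight M)

{-# OPTIONS --safe #-}

-- Every edge of G that M leaves out has an endpoint x saturated by M (degree M x ≡ b x):
-- otherwise inserting it into M would give a heavier b-matching, all weights being positive.
-- Hence |G| ≤ |M| + Σ_{x saturated} deg_G x. A vertex x has at most b x parallel edges to each
-- of the other n - 1 vertices, so deg_G x ≤ (n - 1) b x, while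
-- Σ_{x saturated} b x = Σ_{x saturated} deg_M x ≤ 2|M|. Altogether |G| ≤ (2n - 1) |M|.

module Submission where

open import Defs
open import Data.Nat as ℕ using (ℕ; zero; suc; _+_; _*_; _≤_; _<_; _≰_; z≤n; s≤s)
open import Data.Nat.Properties hiding (_≟_)
open import Data.Nat.ListAction using (sum)
open import Data.Nat.ListAction.Properties using (sum-↭)
open import Data.Nat.Tactic.RingSolver using (solve-∀)
open import Data.Fin using (Fin; zero; suc; _≟_; punchIn)
open import Data.Fin.Properties using (¬∀⟶∃¬; punchInᵢ≢i)
open import Data.Bool using (Bool; true; false; _∨_)
open import Data.Bool.Properties using (∨-zeroʳ)
open import Data.Sum using (_⊎_; inj₁; inj₂)
open import Data.Product using (_×_; _,_; proj₁; proj₂; ∃; ∃₂)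
open import Data.Empty using (⊥-elim)
open import Data.List using (List; []; _∷_; _++_; length; map)
open import Data.List.Relation.Unary.All as All using (All; []; _∷_)
open import Data.List.Membership.Propositional.Properties using (∈-insert)
open import Data.List.Relation.Binary.Sublist.Propositional using (_⊆_; []; _∷_; _∷ʳ_)
open import Data.List.Relation.Binary.Sublist.Propositional.Properties using (All-resp-⊆)
open import Data.List.Relation.Binary.Permutation.Propositional.Properties using (shift; map⁺)
open import Function using (_∘_)
open import Relation.Nullary using (¬_; yes; no)
open import Relation.Nullary.Decidable using (⌊_⌋)
open import Relation.Binary.PropositionalEquality
open import Algebra.Properties.CommutativeSemigroup +-commutativeSemigroup using () renaming (x∙yz≈y∙xz to x+[y+z]≡y+[x+z])
open import Algebra.Properties.CommutativeSemigroup *-commutativeSemigroup using () renaming (x∙yz≈y∙xz to x*[y*z]≡y*[x*z])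
open import Algebra.Properties.Semiring.Sum +-*-semiring
  using (sum-syntax; ∑-distrib-+; *-distribˡ-sum; sum-cong-≗; sum-remove)

private
  variable
    A : Set
    n : ℕ

⟦_⟧ : Bool → ℕ
⟦ true ⟧ = 1
⟦ false ⟧ = 0

⟦∨⟧≤⟦⟧+⟦⟧ : ∀ p q → ⟦ p ∨ q ⟧ ≤ ⟦ p ⟧ + ⟦ q ⟧
⟦∨⟧≤⟦⟧+⟦⟧ true  q = s≤s z≤n
⟦∨⟧≤⟦⟧+⟦⟧ false q = ≤-refl

∑-mono-≤ : {f g : Fin n → ℕ} → (∀ i → f i ≤ g i) → ∑[ i < n ] f i ≤ ∑[ i < n ] g i
∑-mono-≤ {zero}  f≤g = z≤n
∑-mono-≤ {suc n} f≤g = +-mono-≤ (f≤g zero) (∑-mono-≤ (f≤g ∘ suc))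

∑-const : ∀ n c → ∑[ i < n ] c ≡ n * c
∑-const zero    c = refl
∑-const (suc n) c = cong (c +_) (∑-const n c)

term≤∑ : (t : Fin n → ℕ) (i : Fin n) → t i ≤ ∑[ j < n ] t j
term≤∑ {suc n} t i = ≤-trans (m≤m+n (t i) _) (≤-reflexive (sym (sum-remove {i = i} t)))

∑-indicator : (a : Fin n) → ∑[ x < n ] ⟦ ⌊ a ≟ x ⌋ ⟧ ≡ 1
∑-indicator {suc n} a = begin
  ∑[ x < suc n ] ⟦ ⌊ a ≟ x ⌋ ⟧                       ≡⟨ sum-remove {i = a} (λ x → ⟦ ⌊ a ≟ x ⌋ ⟧) ⟩
  ⟦ ⌊ a ≟ a ⌋ ⟧ + ∑[ j < n ] ⟦ ⌊ a ≟ punchIn a j ⌋ ⟧ ≡⟨ cong₂ _+_ diagonal (sum-cong-≗ offDiagonal) ⟩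
  1 + ∑[ j < n ] 0                                    ≡⟨ cong suc (∑-const n 0) ⟩
  suc (n * 0)                                         ≡⟨ cong suc (*-zeroʳ n) ⟩
  1                                                   ∎
  where
  open ≡-Reasoning
  diagonal : ⟦ ⌊ a ≟ a ⌋ ⟧ ≡ 1
  diagonal with a ≟ a
  ... | yes _   = refl
  ... | no a≢a = ⊥-elim (a≢a refl)
  offDiagonal : ∀ j → ⟦ ⌊ a ≟ punchIn a j ⌋ ⟧ ≡ 0
  offDiagonal j with a ≟ punchIn a j
  ... | yes a≡j = ⊥-elim (punchInᵢ≢i a j (sym a≡j))
  ... | no _    = refl

sum-map-mono-≤ : {f g : A → ℕ} (xs : List A) → (∀ x → f x ≤ g x) → sum (map f xs) ≤ sum (map g xs)
sum-map-mono-≤ []       f≤g = z≤n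
sum-map-mono-≤ (x ∷ xs) f≤g = +-mono-≤ (f≤g x) (sum-map-mono-≤ xs f≤g)

sum-map-*ˡ : ∀ c (f : A → ℕ) xs → sum (map (λ x → c * f x) xs) ≡ c * sum (map f xs)
sum-map-*ˡ c f []       = sym (*-zeroʳ c)
sum-map-*ˡ c f (x ∷ xs) = trans (cong (c * f x +_) (sum-map-*ˡ c f xs)) (sym (*-distribˡ-+ c (f x) _))

sum-map-const : ∀ c (xs : List A) → sum (map (λ _ → c) xs) ≡ c * length xs
sum-map-const c []       = sym (*-zeroʳ c)
sum-map-const c (x ∷ xs) = trans (cong (c +_) (sum-map-const c xs)) (sym (*-suc c (length xs)))

sum-map-∑-comm : (h : A → Fin n → ℕ) (xs : List A) →
                 sum (map (λ x → ∑[ i < n ] h x i) xs) ≡ ∑[ i < n ] sum (map (λ x → h x i) xs)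
sum-map-∑-comm {n = n} h []       = sym (trans (∑-const n 0) (*-zeroʳ n))
sum-map-∑-comm         h (x ∷ xs) =
  trans (cong (∑[ i < _ ] h x i +_) (sum-map-∑-comm h xs)) (sym (∑-distrib-+ (h x) _))

countB-∷ : (p : A → Bool) (x : A) (xs : List A) → countB p (x ∷ xs) ≡ ⟦ p x ⟧ + countB p xs
countB-∷ p x xs with p x
... | true  = refl
... | false = refl

countB-insert : (p : A → Bool) (xs : List A) (y : A) (ys : List A) →
                countB p (xs ++ y ∷ ys) ≡ ⟦ p y ⟧ + countB p (xs ++ ys)
countB-insert p []       y ys = countB-∷ p y ys
countB-insert p (x ∷ xs) y ys with p x
... | true  = trans (cong suc (countB-insert p xs y ys)) (sym (+-suc ⟦ p y ⟧ _))
... | false = countB-insert p xs y ys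

countB≡sum : (p : A → Bool) (xs : List A) → countB p xs ≡ sum (map (⟦_⟧ ∘ p) xs)
countB≡sum p []       = refl
countB≡sum p (x ∷ xs) = trans (countB-∷ p x xs) (cong (⟦ p x ⟧ +_) (countB≡sum p xs))

weight-insert : (xs : List (Edge n)) (e : Edge n) (ys : List (Edge n)) →
                weight (xs ++ e ∷ ys) ≡ wt e + weight (xs ++ ys)
weight-insert xs e ys = sum-↭ (map⁺ wt (shift e xs ys))

-- Sublists respect order, so y must be inserted into xs at a position compatible with ys.
Insertable : List A → List A → A → Set
Insertable xs ys y = ∃₂ λ pre suf → xs ≡ pre ++ suf × pre ++ y ∷ suf ⊆ ys

length≤length+sum-insertable : (f : A → ℕ) {xs ys : List A} →
                               (∀ {y} → Insertable xs ys y → 1 ≤ f y) →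
                               xs ⊆ ys → length ys ≤ length xs + sum (map f ys)
length≤length+sum-insertable f ins [] = z≤n
length≤length+sum-insertable f {xs} {y ∷ ys} ins (.y ∷ʳ xs⊆ys) =
  ≤-trans (+-mono-≤ (ins ([] , xs , refl , refl ∷ xs⊆ys)) IH)
          (≤-reflexive (x+[y+z]≡y+[x+z] (f y) (length xs) _))
  where
  IH : length ys ≤ length xs + sum (map f ys)
  IH = length≤length+sum-insertable f (λ (pre , suf , eq , ⊆ys) → ins (pre , suf , eq , y ∷ʳ ⊆ys)) xs⊆ys
length≤length+sum-insertable f {y ∷ xs} {y ∷ ys} ins (refl ∷ xs⊆ys) =
  s≤s (≤-trans IH (+-monoʳ-≤ (length xs) (m≤n+m _ (f y))))
  where
  IH : length ys ≤ length xs + sum (map f ys)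
  IH = length≤length+sum-insertable f
         (λ (pre , suf , eq , ⊆ys) → ins (y ∷ pre , suf , cong (y ∷_) eq , refl ∷ ⊆ys)) xs⊆ys

incident⇒endpoint : (x : Fin n) (e : Edge n) → incident x e ≡ true → src e ≡ x ⊎ dst e ≡ x
incident⇒endpoint x e _ with src e ≟ x | dst e ≟ x
incident⇒endpoint x e _  | yes src≡x | _         = inj₁ src≡x
incident⇒endpoint x e _  | no _      | yes dst≡x = inj₂ dst≡x
incident⇒endpoint x e () | no _      | no _

joins-src-dst : (e : Edge n) → joins (src e) (dst e) e ≡ true
joins-src-dst e with src e ≟ src e | dst e ≟ dst e
... | yes _      | yes _      = refl
... | no src≢src | _          = ⊥-elim (src≢src refl)
... | yes _      | no dst≢dst = ⊥-elim (dst≢dst refl)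

joins-dst-src : (e : Edge n) → joins (dst e) (src e) e ≡ true
joins-dst-src e with src e ≟ src e | dst e ≟ dst e
... | yes _      | yes _      = ∨-zeroʳ _
... | no src≢src | _          = ⊥-elim (src≢src refl)
... | yes _      | no dst≢dst = ⊥-elim (dst≢dst refl)

Loopless : Edge n → Set
Loopless e = src e ≢ dst e

joins-loopless : (x : Fin n) (e : Edge n) → Loopless e → joins x x e ≡ false
joins-loopless x e src≢dst with src e ≟ x | dst e ≟ x
... | yes refl | yes dst≡x = ⊥-elim (src≢dst (sym dst≡x))
... | yes _    | no _      = refl
... | no _     | yes _     = refl
... | no _     | no _      = refl

⟦incident⟧≤∑⟦joins⟧ : (x : Fin n) (e : Edge n) → ⟦ incident x e ⟧ ≤ ∑[ y < n ] ⟦ joins x y e ⟧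
⟦incident⟧≤∑⟦joins⟧ {n} x e with incident x e in incident≡
... | false = z≤n
... | true with incident⇒endpoint x e incident≡
... | inj₁ refl = subst (_≤ ∑[ y < n ] ⟦ joins x y e ⟧) (cong ⟦_⟧ (joins-src-dst e)) (term≤∑ _ (dst e))
... | inj₂ refl = subst (_≤ ∑[ y < n ] ⟦ joins x y e ⟧) (cong ⟦_⟧ (joins-dst-src e)) (term≤∑ _ (src e))

countB-joins-loopless : (x : Fin n) {L : List (Edge n)} → All Loopless L → countB (joins x x) L ≡ 0
countB-joins-loopless x []                             = refl
countB-joins-loopless x {e ∷ L} (src≢dst ∷ loopless) rewrite joins-loopless x e src≢dst =
  countB-joins-loopless x loopless

degree≤∑multiplicity : (L : List (Edge n)) (x : Fin n) → degree L x ≤ ∑[ y < n ] countB (joins x y) L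
degree≤∑multiplicity {n} L x = begin
  degree L x                                       ≡⟨ countB≡sum (incident x) L ⟩
  sum (map (⟦_⟧ ∘ incident x) L)                   ≤⟨ sum-map-mono-≤ L (⟦incident⟧≤∑⟦joins⟧ x) ⟩
  sum (map (λ e → ∑[ y < n ] ⟦ joins x y e ⟧) L) ≡⟨ sum-map-∑-comm (λ e y → ⟦ joins x y e ⟧) L ⟩
  ∑[ y < n ] sum (map (⟦_⟧ ∘ joins x y) L)        ≡⟨ sum-cong-≗ (λ y → sym (countB≡sum (joins x y) L)) ⟩
  ∑[ y < n ] countB (joins x y) L                  ∎
  where open ≤-Reasoning

degree≤pred*multiplicity : ∀ {k} c (L : List (Edge (suc k))) (x : Fin (suc k)) → All Loopless L →
                           (∀ y → y ≢ x → countB (joins x y) L ≤ c) → degree L x ≤ k * c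
degree≤pred*multiplicity {k} c L x loopless multiplicity≤c = begin
  degree L x                                                     ≤⟨ degree≤∑multiplicity L x ⟩
  ∑[ y < suc k ] countB (joins x y) L                            ≡⟨ sum-remove {i = x} (λ y → countB (joins x y) L) ⟩
  countB (joins x x) L + ∑[ j < k ] countB (joins x (punchIn x j)) L
    ≡⟨ cong (_+ ∑[ j < k ] countB (joins x (punchIn x j)) L) (countB-joins-loopless x loopless) ⟩
  ∑[ j < k ] countB (joins x (punchIn x j)) L                    ≤⟨ ∑-mono-≤ (λ j → multiplicity≤c _ (punchInᵢ≢i x j)) ⟩
  ∑[ j < k ] c                                                   ≡⟨ ∑-const k c ⟩
  k * c                                                          ∎
  where open ≤-Reasoning

∑degree≤2*length : (L : List (Edge n)) → ∑[ x < n ] degree L x ≤ 2 * length L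
∑degree≤2*length {n} L = begin
  ∑[ x < n ] degree L x                            ≡⟨ sum-cong-≗ (λ x → countB≡sum (incident x) L) ⟩
  ∑[ x < n ] sum (map (⟦_⟧ ∘ incident x) L)       ≡⟨ sum-map-∑-comm (λ e x → ⟦ incident x e ⟧) L ⟨
  sum (map (λ e → ∑[ x < n ] ⟦ incident x e ⟧) L) ≤⟨ sum-map-mono-≤ L endpoints≤2 ⟩
  sum (map (λ _ → 2) L)                            ≡⟨ sum-map-const 2 L ⟩
  2 * length L                                     ∎
  where
  open ≤-Reasoning
  endpoints≤2 : (e : Edge n) → ∑[ x < n ] ⟦ incident x e ⟧ ≤ 2
  endpoints≤2 e = begin
    ∑[ x < n ] ⟦ incident x e ⟧                                    ≤⟨ ∑-mono-≤ (λ x → ⟦∨⟧≤⟦⟧+⟦⟧ ⌊ src e ≟ x ⌋ ⌊ dst e ≟ x ⌋) ⟩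
    ∑[ x < n ] (⟦ ⌊ src e ≟ x ⌋ ⟧ + ⟦ ⌊ dst e ≟ x ⌋ ⟧)             ≡⟨ ∑-distrib-+ (λ x → ⟦ ⌊ src e ≟ x ⌋ ⟧) (λ x → ⟦ ⌊ dst e ≟ x ⌋ ⟧) ⟩
    ∑[ x < n ] ⟦ ⌊ src e ≟ x ⌋ ⟧ + ∑[ x < n ] ⟦ ⌊ dst e ≟ x ⌋ ⟧    ≡⟨ cong₂ _+_ (∑-indicator (src e)) (∑-indicator (dst e)) ⟩
    2                                                               ∎

∑-weighted-degree : (g : Fin n → ℕ) (L : List (Edge n)) →
                    sum (map (λ e → ∑[ x < n ] (g x * ⟦ incident x e ⟧)) L) ≡ ∑[ x < n ] (g x * degree L x)
∑-weighted-degree {n} g L = begin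
  sum (map (λ e → ∑[ x < n ] (g x * ⟦ incident x e ⟧)) L) ≡⟨ sum-map-∑-comm (λ e x → g x * ⟦ incident x e ⟧) L ⟩
  ∑[ x < n ] sum (map (λ e → g x * ⟦ incident x e ⟧) L) ≡⟨ sum-cong-≗ (λ x → sum-map-*ˡ (g x) (⟦_⟧ ∘ incident x) L) ⟩
  ∑[ x < n ] (g x * sum (map (⟦_⟧ ∘ incident x) L))       ≡⟨ sum-cong-≗ (λ x → cong (g x *_) (countB≡sum (incident x) L)) ⟨
  ∑[ x < n ] (g x * degree L x)                            ∎
  where open ≡-Reasoning

saturated : (Fin n → ℕ) → List (Edge n) → Fin n → ℕ
saturated b M x = ⟦ ⌊ degree M x ℕ.≟ b x ⌋ ⟧

charge : (Fin n → ℕ) → List (Edge n) → Edge n → ℕ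
charge {n} b M e = ∑[ x < n ] (saturated b M x * ⟦ incident x e ⟧)

saturated*capacity≤degree : (b : Fin n → ℕ) (M : List (Edge n)) (x : Fin n) → saturated b M x * b x ≤ degree M x
saturated*capacity≤degree b M x with degree M x ℕ.≟ b x
... | yes degree≡b = ≤-reflexive (trans (+-identityʳ (b x)) (sym degree≡b))
... | no _         = z≤n

⟦i⟧+d≰c⇒i≡true×d≡c : ∀ i {d c} → ⟦ i ⟧ + d ≰ c → d ≤ c → i ≡ true × d ≡ c
⟦i⟧+d≰c⇒i≡true×d≡c false d≰c   d≤c = ⊥-elim (d≰c d≤c)
⟦i⟧+d≰c⇒i≡true×d≡c true  1+d≰c d≤c = refl , ≤-antisym d≤c (≤-pred (≰⇒> 1+d≰c))

insertable⇒saturated-endpoint : {b : Fin n → ℕ} {G M : List (Edge n)} {e : Edge n} →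
                                IsMaxWeightBMatching b G M → 1 ≤ wt e → Insertable M G e →
                                ∃ λ x → incident x e ≡ true × degree M x ≡ b x
insertable⇒saturated-endpoint {n} {b} {e = e} ((_ , degree≤b) , maximum) 1≤wt (pre , suf , refl , M′⊆G) =
  let x , M′x≰b = ¬∀⟶∃¬ n (λ x → degree M′ x ≤ b x) (λ x → degree M′ x ℕ.≤? b x) M′-exceeds-capacity
      ⟦incident⟧+degree≰b = subst (_≰ b x) (countB-insert (incident x) pre e suf) M′x≰b
  in x , ⟦i⟧+d≰c⇒i≡true×d≡c (incident x e) ⟦incident⟧+degree≰b (degree≤b x)
  where
  M′ : List (Edge n)
  M′ = pre ++ e ∷ suf
  M′-exceeds-capacity : ¬ (∀ x → degree M′ x ≤ b x)
  M′-exceeds-capacity M′≤b = <⇒≱ heavier (maximum M′ (M′⊆G , M′≤b))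
    where
    heavier : weight (pre ++ suf) < weight M′
    heavier = subst (weight (pre ++ suf) <_) (sym (weight-insert pre e suf)) (+-monoˡ-≤ _ 1≤wt)

1≤charge : {b : Fin n → ℕ} {G M : List (Edge n)} {e : Edge n} →
           IsMaxWeightBMatching b G M → 1 ≤ wt e → Insertable M G e → 1 ≤ charge b M e
1≤charge {b = b} {M = M} {e} maximal 1≤wt insertable
  with x , incident≡true , full ← insertable⇒saturated-endpoint maximal 1≤wt insertable =
  subst (_≤ charge b M e) covered (term≤∑ (λ y → saturated b M y * ⟦ incident y e ⟧) x)
  where
  covered : saturated b M x * ⟦ incident x e ⟧ ≡ 1
  covered with degree M x ℕ.≟ b x
  ... | yes _       rewrite incident≡true = refl
  ... | no degree≢b = ⊥-elim (degree≢b full)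

size≤size+∑charge : {b : Fin n → ℕ} {G M : List (Edge n)} → All (λ e → 1 ≤ wt e) G →
                    IsMaxWeightBMatching b G M → size G ≤ size M + sum (map (charge b M) G)
size≤size+∑charge weights maximal@((M⊆G , _) , _) =
  length≤length+sum-insertable _ (λ insertable@(pre , _ , _ , M′⊆G) →
    1≤charge maximal (All.lookup (All-resp-⊆ M′⊆G weights) (∈-insert pre)) insertable) M⊆G

∑charge≤pred*∑saturated*capacity :
  ∀ {k} (b : Fin (suc k) → ℕ) (G M : List (Edge (suc k))) → All Loopless G →
  (∀ x y → x ≢ y → countB (joins x y) G ≤ b x) →
  sum (map (charge b M) G) ≤ k * ∑[ x < suc k ] (saturated b M x * b x)
∑charge≤pred*∑saturated*capacity {k} b G M loopless multiplicity≤b = begin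
  sum (map (charge b M) G)                         ≡⟨ ∑-weighted-degree (saturated b M) G ⟩
  ∑[ x < suc k ] (saturated b M x * degree G x)     ≤⟨ ∑-mono-≤ (λ x → *-monoʳ-≤ (saturated b M x) (degree≤pred*capacity x)) ⟩
  ∑[ x < suc k ] (saturated b M x * (k * b x))      ≡⟨ sum-cong-≗ (λ x → x*[y*z]≡y*[x*z] (saturated b M x) k (b x)) ⟩
  ∑[ x < suc k ] (k * (saturated b M x * b x))      ≡⟨ *-distribˡ-sum k (λ x → saturated b M x * b x) ⟨
  k * ∑[ x < suc k ] (saturated b M x * b x)        ∎
  where
  open ≤-Reasoning
  degree≤pred*capacity : ∀ x → degree G x ≤ k * b x
  degree≤pred*capacity x = degree≤pred*multiplicity (b x) G x loopless (λ y y≢x → multiplicity≤b x y (y≢x ∘ sym))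

∑saturated*capacity≤2*size : (b : Fin n → ℕ) (M : List (Edge n)) →
                             ∑[ x < n ] (saturated b M x * b x) ≤ 2 * size M
∑saturated*capacity≤2*size b M = ≤-trans (∑-mono-≤ (saturated*capacity≤degree b M)) (∑degree≤2*length M)

lemma24 : (n W : ℕ) (b : Fin n → ℕ) (G : WMultiGraph n) (M : List (Edge n))
    → ValidGraph W b G
    → IsMaxWeightBMatching b G M
    → size G ≤ 2 * n * size M
lemma24 zero    _ _ []                 _ _ _ = z≤n
lemma24 zero    _ _ (edge () _ _ ∷ _) _ _ _
lemma24 (suc k) _ b G M (edgeConditions , _ , multiplicity≤) maximal = begin
  size G
    ≤⟨ size≤size+∑charge weights maximal ⟩
  size M + sum (map (charge b M) G)
    ≤⟨ +-monoʳ-≤ (size M) (∑charge≤pred*∑saturated*capacity b G M loopless multiplicity≤b) ⟩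
  size M + k * ∑[ x < suc k ] (saturated b M x * b x)
    ≤⟨ +-monoʳ-≤ (size M) (*-monoʳ-≤ k (∑saturated*capacity≤2*size b M)) ⟩
  size M + k * (2 * size M)
    ≤⟨ m≤n+m _ (size M) ⟩
  size M + (size M + k * (2 * size M))
    ≡⟨ rearrange k (size M) ⟩
  2 * suc k * size M
    ∎
  where
  open ≤-Reasoning
  loopless : All Loopless G
  loopless = All.map proj₁ edgeConditions
  weights : All (λ e → 1 ≤ wt e) G
  weights = All.map (proj₁ ∘ proj₂) edgeConditions
  multiplicity≤b : ∀ x y → x ≢ y → countB (joins x y) G ≤ b x
  multiplicity≤b x y x≢y = ≤-trans (multiplicity≤ x y x≢y) (m⊓n≤m (b x) (b y))
  rearrange : ∀ k m → m + (m + k * (2 * m)) ≡ 2 * suc k * m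
  rearrange = solve-∀
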